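{- Let $0\le q<1$, let $w=(w_{\ell,j})_{1\le\ell\le N,1\le j\le m}$ be a matrix of nonnegative integers, and let $(\lambda^j_k(\ell))$ and $(a^j_k(\ell))$ be the GT patterns and auxiliary variables produced by $q$RSK applied to $w$ from the empty initial condition. Then for $1\le n\le N$ and $n\le k\le m$, almost surely $$\lambda^k_n(n)=\begin{cases}\lambda^{k-1}_n(n)+a^k_n(n)&k>n,\\ a^k_n(n)&k=n.\end{cases}$$
   Context: Notation: $(k)_q=(q;q)_k$, $\binom{a}{b}_q=\frac{(a)_q}{(b)_q(a-b)_q}$, $0^0=1$. $q\mathrm{Hyp}(m_1,m_2,k)$ ($m_1,k\in\mathbb N$, $m_2\in\mathbb N\cup\{\infty\}$) has pmf $s\mapsto q^{(m_1-s)(k-s)}\binom{m_1}{s}_q\binom{m_2}{k-s}_q/\binom{m_1+m_2}{k}_q$ on $\max(0,k-m_2)\le s\le\min(m_1,k)$ (for $m_2=\infty$: $q^{(m_1-s)(k-s)}\frac{(m_1)_q(k)_q}{(s)_q(m_1-s)_q(k-s)_q}$). $q$RSK: GT patterns $(\lambda^j_k)_{1\le k\le j\le m}$ with $\lambda^{j+1}_{k+1}\le\lambda^j_k\le\lambda^{j+1}_k$; conventions $\lambda^j_0=\infty$, $\lambda^j_k=0$ for $k>j$, level-$0$ entries $0$. At time $\ell$, insert row $(w_{\ell,1},\dots,w_{\ell,m})$ into $\lambda=\lambda(\ell-1)$ to get $\tilde\lambda=\lambda(\ell)$: set $a^j_1(\ell)=w_{\ell,j}$; for $j=1,\dots,m$,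 for $k=1,\dots,j$: if $k<j$, sample independently $a^j_{k+1}(\ell)\sim q\mathrm{Hyp}(\tilde\lambda^{j-1}_k-\lambda^{j-1}_k,\lambda^{j-1}_{k-1}-\tilde\lambda^{j-1}_k,\lambda^j_k-\lambda^{j-1}_k)$ and set $\tilde\lambda^j_k=a^j_k(\ell)+\lambda^j_k+\tilde\lambda^{j-1}_k-\lambda^{j-1}_k-a^j_{k+1}(\ell)$; if $k=j$ set $\tilde\lambda^j_j=\lambda^j_j+a^j_j(\ell)$. Empty initial condition: $\lambda(0)\equiv0$. -}

module Defs where

open import Data.Nat using (ℕ; zero; suc; _+_; _*_; _∸_; _≤_; _<_; _<ᵇ_; _≡ᵇ_)
open import Data.Nat.Properties using (_<?_)
open import Data.Bool using (if_then_else_)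
open import Data.Fin using (Fin; fromℕ<)
open import Data.Maybe using (Maybe; just; nothing)
open import Data.Product using (_×_)
open import Data.Unit using (⊤)
open import Relation.Nullary using (yes; no; ¬_)
open import Relation.Binary.PropositionalEquality using (_≡_)
open import Data.Rational as ℚ using (ℚ; 0ℚ; 1ℚ)

qpow : ℚ → ℕ → ℚ
qpow q zero    = 1ℚ
qpow q (suc n) = q ℚ.* qpow q n

-- ℕ ∪ {∞}: nothing = ∞
ℕ∞ : Set
ℕ∞ = Maybe ℕ

-- All q-Pochhammer factors (i)_q are > 0 for 0 ≤ q < 1, so the
-- pmf at s is nonzero iff the factor q^{(m₁-s)(k-s)} is nonzero.
InSupp : ℚ → ℕ → ℕ∞ → ℕ → ℕ → Set
InSupp q m₁ (just m₂) k s =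
  (k ∸ m₂ ≤ s) × (s ≤ m₁) × (s ≤ k) × (¬ (qpow q ((m₁ ∸ s) * (k ∸ s)) ≡ 0ℚ))
InSupp q m₁ nothing k s =
  (s ≤ m₁) × (s ≤ k) × (¬ (qpow q ((m₁ ∸ s) * (k ∸ s)) ≡ 0ℚ))

-- The input matrix w = (w_{ℓ,j}), 1 ≤ ℓ ≤ N, 1 ≤ j ≤ m, read with 1-based
-- natural-number indices (value 0 outside the range, never used).
entry : {N m : ℕ} → (Fin N → Fin m → ℕ) → ℕ → ℕ → ℕ
entry {N} {m} w zero j = 0
entry {N} {m} w (suc ℓ) zero = 0
entry {N} {m} w (suc ℓ) (suc j) with ℓ <? N | j <? m
... | yes p | yes r = w (fromℕ< p) (fromℕ< r)
... | _     | _     = 0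

-- A sample path of the randomness of qRSK is given by the values
-- A ℓ j k  (intended for the sampled variables a^j_k(ℓ), 2 ≤ k ≤ j).
aux : {N m : ℕ} → (Fin N → Fin m → ℕ) → (ℕ → ℕ → ℕ → ℕ) → ℕ → ℕ → ℕ → ℕ
aux w A ℓ j zero          = 0
aux w A ℓ j (suc zero)    = entry w ℓ j
aux w A ℓ j (suc (suc k)) = A ℓ j (suc (suc k))

-- One insertion step at time ℓ: given old = λ(ℓ-1) (as old j k = λ^j_k),
-- compute new = λ(ℓ) level by level.  Level 0 entries are 0, λ^j_k = 0 for k > j.
-- (The index k = 0, i.e. λ^j_0 = ∞, is never stored; it is handled in ValidRun.)
insertStep : {N m : ℕ} → (Fin N → Fin m → ℕ) → (ℕ → ℕ → ℕ → ℕ) →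
             ℕ → (ℕ → ℕ → ℕ) → ℕ → ℕ → ℕ
insertStep w A ℓ old zero    k = 0
insertStep w A ℓ old (suc j) zero = 0
insertStep w A ℓ old (suc j) (suc k) =
  if suc k <ᵇ suc j
  then (aux w A ℓ (suc j) (suc k) + old (suc j) (suc k)
          + (insertStep w A ℓ old j (suc k) ∸ old j (suc k)))
        ∸ aux w A ℓ (suc j) (suc (suc k))
  else (if suc k ≡ᵇ suc j
        then old (suc j) (suc j) + aux w A ℓ (suc j) (suc j)
        else 0)

-- GT pattern λ(ℓ) produced by qRSK from the empty initial condition:
-- Λ w A ℓ j k = λ^j_k(ℓ).
Λ : {N m : ℕ} → (Fin N → Fin m → ℕ) → (ℕ → ℕ → ℕ → ℕ) → ℕ → ℕ → ℕ → ℕ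
Λ w A zero    j k = 0
Λ w A (suc ℓ) j k = insertStep w A (suc ℓ) (Λ w A ℓ) j k

-- λ^j_{k-1} as an element of ℕ ∪ {∞} (λ^j_0 = ∞).
Λprev : {N m : ℕ} → (Fin N → Fin m → ℕ) → (ℕ → ℕ → ℕ → ℕ) → ℕ → ℕ → ℕ → ℕ∞
Λprev w A ℓ j zero    = nothing   -- unused (k ≥ 1 always)
Λprev w A ℓ j (suc zero) = nothing
Λprev w A ℓ j (suc (suc k)) = just (Λ w A ℓ j (suc k))

-- A sample path A has positive probability: for every time 1 ≤ ℓ ≤ N and
-- all 1 ≤ k < j ≤ m, the sampled value a^j_{k+1}(ℓ) lies in the support of
-- qHyp(λ̃^{j-1}_k - λ^{j-1}_k, λ^{j-1}_{k-1} - λ̃^{j-1}_k, λ^j_k - λ^{j-1}_k),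
-- with λ = λ(ℓ-1), λ̃ = λ(ℓ).
sub∞ : ℕ∞ → ℕ → ℕ∞
sub∞ nothing  x = nothing
sub∞ (just y) x = just (y ∸ x)

ValidRun : ℚ → (N m : ℕ) → (Fin N → Fin m → ℕ) → (ℕ → ℕ → ℕ → ℕ) → Set
ValidRun q N m w A =
  ∀ ℓ j k → 1 ≤ ℓ → ℓ ≤ N → 1 ≤ k → k < j → j ≤ m →
  InSupp q
    (Λ w A ℓ (j ∸ 1) k ∸ Λ w A (ℓ ∸ 1) (j ∸ 1) k)
    (sub∞ (Λprev w A (ℓ ∸ 1) (j ∸ 1) k) (Λ w A ℓ (j ∸ 1) k))
    (Λ w A (ℓ ∸ 1) j k ∸ Λ w A (ℓ ∸ 1) (j ∸ 1) k)
    (aux w A ℓ j (suc k))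

module Submission where

open import Defs
open import Data.Nat using (ℕ; _≤_; _<_; _∸_; _+_; zero; suc; z≤n; s≤s; _<ᵇ_; _≡ᵇ_)
open import Data.Nat.Properties
  using (<ᵇ⇒<; <⇒<ᵇ; ≡ᵇ⇒≡; ≡⇒≡ᵇ; <-irrefl; <-asym; <⇒≢; <-cmp; <⇒≤; ≤-refl;
         m<n⇒0<n; m<n⇒m<1+n; n≤0⇒n≡0; 0∸n≡0; +-identityʳ; +-comm)
open import Data.Bool using (true; false)
open import Data.Fin using (Fin)
open import Data.Product using (_×_; _,_)
open import Data.Empty using (⊥-elim)
open import Data.Maybe using (just; nothing)
open import Relation.Binary using (tri<; tri≈; tri>)
open import Relation.Binary.PropositionalEquality
  using (_≡_; refl; sym; subst; cong; module ≡-Reasoning)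
open import Data.Rational using (ℚ; 0ℚ; 1ℚ)
open import Data.Rational as Q using ()

-- A run of qRSK from the empty initial condition has λ^j_k(ℓ) = 0 for k > ℓ:
-- inserting a row can grow the pattern by at most one nonempty row.  Indeed the
-- sample a^j_{k+1}(ℓ) is bounded by its third qHyp parameter λ^j_k(ℓ-1) - λ^{j-1}_k(ℓ-1),
-- which vanishes once k > ℓ - 1, so every term of the update rule for λ^j_k(ℓ) is zero.
-- At time n the same vanishing kills λ^k_n(n-1), λ^{k-1}_n(n-1) and a^k_{n+1}(n) in the
-- update rule for λ^k_n(n), leaving exactly λ^{k-1}_n(n) + a^k_n(n).
-- Only this bound on the support of qHyp is used; the value of q plays no role.

InSupp-≤ : ∀ {q m₁ m₂ k s} → InSupp q m₁ m₂ k s → s ≤ k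
InSupp-≤ {m₂ = just _}  (_ , _ , s≤k , _) = s≤k
InSupp-≤ {m₂ = nothing} (_ , s≤k , _)     = s≤k

module _ {N m : ℕ} (w : Fin N → Fin m → ℕ) (A : ℕ → ℕ → ℕ → ℕ)
         (ℓ : ℕ) (old : ℕ → ℕ → ℕ) where

  insertStep-< : ∀ {j k} → k < j →
    insertStep w A ℓ old (suc j) (suc k)
      ≡ (aux w A ℓ (suc j) (suc k) + old (suc j) (suc k)
           + (insertStep w A ℓ old j (suc k) ∸ old j (suc k)))
        ∸ aux w A ℓ (suc j) (suc (suc k))
  insertStep-< {j} {k} k<j with k <ᵇ j | <⇒<ᵇ k<j
  ... | true | _ = refl

  insertStep-diagonal : ∀ j →
    insertStep w A ℓ old (suc j) (suc j) ≡ old (suc j) (suc j) + aux w A ℓ (suc j) (suc j)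
  insertStep-diagonal j with j <ᵇ j | <ᵇ⇒< j j
  ... | true  | j<j = ⊥-elim (<-irrefl refl (j<j _))
  ... | false | _ with j ≡ᵇ j | ≡⇒≡ᵇ j j refl
  ...   | true | _ = refl

  insertStep-> : ∀ {j k} → j < k → insertStep w A ℓ old (suc j) (suc k) ≡ 0
  insertStep-> {j} {k} j<k with k <ᵇ j | <ᵇ⇒< k j
  ... | true  | k<j = ⊥-elim (<-asym j<k (k<j _))
  ... | false | _ with k ≡ᵇ j | ≡ᵇ⇒≡ k j
  ...   | true  | k≡j = ⊥-elim (<⇒≢ j<k (sym (k≡j _)))
  ...   | false | _   = refl

module _ {q : ℚ} {N m : ℕ} {w : Fin N → Fin m → ℕ} {A : ℕ → ℕ → ℕ → ℕ}
         (valid : ValidRun q N m w A) where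

  aux-vanishes : ∀ {ℓ j k} → suc ℓ ≤ N → 1 ≤ k → k < j → j ≤ m →
    Λ w A ℓ j k ≡ 0 → aux w A (suc ℓ) j (suc k) ≡ 0
  aux-vanishes {ℓ} {j} {k} ℓ<N 1≤k k<j j≤m λ≡0 =
    n≤0⇒n≡0 (subst (aux w A (suc ℓ) j (suc k) ≤_) parameter≡0
                   (InSupp-≤ (valid (suc ℓ) j k (s≤s z≤n) ℓ<N 1≤k k<j j≤m)))
    where
    parameter≡0 : Λ w A ℓ j k ∸ Λ w A ℓ (j ∸ 1) k ≡ 0
    parameter≡0 rewrite λ≡0 = 0∸n≡0 (Λ w A ℓ (j ∸ 1) k)

  Λ-vanishes-succ : ∀ {ℓ} → suc ℓ ≤ N →
    (∀ {j k} → j ≤ m → ℓ < k → Λ w A ℓ j k ≡ 0) →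
    ∀ {j k} → j ≤ m → suc ℓ < k → Λ w A (suc ℓ) j k ≡ 0
  Λ-vanishes-succ         ℓ<N ih {zero}          _   _         = refl
  Λ-vanishes-succ {ℓ} ℓ<N ih {suc j} {suc k} j<m (s≤s ℓ<k) with <-cmp k j
  ... | tri< k<j _ _ = begin
    Λ w A (suc ℓ) (suc j) (suc k)
      ≡⟨ insertStep-< w A (suc ℓ) (Λ w A ℓ) k<j ⟩
    (aux w A (suc ℓ) (suc j) (suc k) + Λ w A ℓ (suc j) (suc k)
        + (Λ w A (suc ℓ) j (suc k) ∸ Λ w A ℓ j (suc k)))
      ∸ aux w A (suc ℓ) (suc j) (suc (suc k))
      ≡⟨ cong (_∸ aux w A (suc ℓ) (suc j) (suc (suc k))) vanishing-terms ⟩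
    0 ∸ aux w A (suc ℓ) (suc j) (suc (suc k))
      ≡⟨ 0∸n≡0 (aux w A (suc ℓ) (suc j) (suc (suc k))) ⟩
    0 ∎
    where
    open ≡-Reasoning
    vanishing-terms : aux w A (suc ℓ) (suc j) (suc k) + Λ w A ℓ (suc j) (suc k)
                        + (Λ w A (suc ℓ) j (suc k) ∸ Λ w A ℓ j (suc k)) ≡ 0
    vanishing-terms
      rewrite aux-vanishes ℓ<N (m<n⇒0<n ℓ<k) (m<n⇒m<1+n k<j) j<m (ih j<m ℓ<k)
            | ih {suc j} j<m (m<n⇒m<1+n ℓ<k)
            | Λ-vanishes-succ ℓ<N ih {j} (<⇒≤ j<m) (s≤s ℓ<k)
            | ih {j} (<⇒≤ j<m) (m<n⇒m<1+n ℓ<k)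
            = refl
  ... | tri≈ _ refl _ = begin
    Λ w A (suc ℓ) (suc k) (suc k)
      ≡⟨ insertStep-diagonal w A (suc ℓ) (Λ w A ℓ) k ⟩
    Λ w A ℓ (suc k) (suc k) + aux w A (suc ℓ) (suc k) (suc k)
      ≡⟨ cong (_+ aux w A (suc ℓ) (suc k) (suc k)) (ih j<m (m<n⇒m<1+n ℓ<k)) ⟩
    aux w A (suc ℓ) (suc k) (suc k)
      ≡⟨ aux-vanishes ℓ<N (m<n⇒0<n ℓ<k) ≤-refl j<m (ih j<m ℓ<k) ⟩
    0 ∎
    where open ≡-Reasoning
  ... | tri> _ _ j<k = insertStep-> w A (suc ℓ) (Λ w A ℓ) j<k

  Λ-vanishes : ∀ {ℓ j k} → ℓ ≤ N → j ≤ m → ℓ < k → Λ w A ℓ j k ≡ 0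
  Λ-vanishes {zero}  _   _ _ = refl
  Λ-vanishes {suc ℓ} ℓ<N     = Λ-vanishes-succ ℓ<N (Λ-vanishes (<⇒≤ ℓ<N))

  Λ-newRow : ∀ {n k} → suc n ≤ N → suc k ≤ m → n < k →
    Λ w A (suc n) (suc k) (suc n) ≡ Λ w A (suc n) k (suc n) + aux w A (suc n) (suc k) (suc n)
  Λ-newRow {n} {k} n<N k<m n<k = begin
    Λ w A (suc n) (suc k) (suc n)
      ≡⟨ insertStep-< w A (suc n) (Λ w A n) n<k ⟩
    (aux w A (suc n) (suc k) (suc n) + Λ w A n (suc k) (suc n)
        + (Λ w A (suc n) k (suc n) ∸ Λ w A n k (suc n)))
      ∸ aux w A (suc n) (suc k) (suc (suc n))
      ≡⟨ unborn-terms-vanish ⟩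
    aux w A (suc n) (suc k) (suc n) + Λ w A (suc n) k (suc n)
      ≡⟨ +-comm (aux w A (suc n) (suc k) (suc n)) _ ⟩
    Λ w A (suc n) k (suc n) + aux w A (suc n) (suc k) (suc n) ∎
    where
    open ≡-Reasoning
    unborn : ∀ {j} → j ≤ m → Λ w A n j (suc n) ≡ 0
    unborn j≤m = Λ-vanishes (<⇒≤ n<N) j≤m ≤-refl
    unborn-terms-vanish :
      (aux w A (suc n) (suc k) (suc n) + Λ w A n (suc k) (suc n)
          + (Λ w A (suc n) k (suc n) ∸ Λ w A n k (suc n)))
        ∸ aux w A (suc n) (suc k) (suc (suc n))
      ≡ aux w A (suc n) (suc k) (suc n) + Λ w A (suc n) k (suc n)
    unborn-terms-vanish
      rewrite aux-vanishes n<N (s≤s z≤n) (s≤s n<k) k<m (unborn k<m)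
            | unborn k<m
            | unborn (<⇒≤ k<m)
            = cong (_+ Λ w A (suc n) k (suc n)) (+-identityʳ _)

  Λ-newRow-diagonal : ∀ {n} → suc n ≤ N → suc n ≤ m →
    Λ w A (suc n) (suc n) (suc n) ≡ aux w A (suc n) (suc n) (suc n)
  Λ-newRow-diagonal {n} n<N n<m = begin
    Λ w A (suc n) (suc n) (suc n)
      ≡⟨ insertStep-diagonal w A (suc n) (Λ w A n) n ⟩
    Λ w A n (suc n) (suc n) + aux w A (suc n) (suc n) (suc n)
      ≡⟨ cong (_+ aux w A (suc n) (suc n) (suc n)) (Λ-vanishes (<⇒≤ n<N) n<m ≤-refl) ⟩
    aux w A (suc n) (suc n) (suc n) ∎
    where open ≡-Reasoning

lemma2p6 : (q : ℚ) → 0ℚ Q.≤ q → q Q.< 1ℚ →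
    (N m : ℕ) (w : Fin N → Fin m → ℕ) (A : ℕ → ℕ → ℕ → ℕ) →
    ValidRun q N m w A →
    ∀ n k → 1 ≤ n → n ≤ N → n ≤ k → k ≤ m →
      (n < k → Λ w A n k n ≡ Λ w A n (k ∸ 1) n + aux w A n k n)
      × (k ≡ n → Λ w A n k n ≡ aux w A n k n)
lemma2p6 q _ _ N m w A valid (suc n) (suc k) _ n<N _ k<m =
  (λ { (s≤s n<k) → Λ-newRow valid n<N k<m n<k }) ,
  (λ { refl → Λ-newRow-diagonal valid n<N k<m })
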